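{- The map $\gamma$ restricts to a bijection from $\mathrm{RGF}$ onto $\mathrm{Flat}=S(23\text{ - }1)$, and for any permutation $\sigma$ and any Cayley permutation $y$, $$\mathrm{Flat}(\sigma)=\gamma\bigl(\mathrm{RGF}[\sigma^{ -1}]\bigr)\quad\text{and}\quad \gamma\bigl(\mathrm{RGF}[y]\bigr)=\mathrm{Flat}\bigl(\gamma(y)\bigr).$$ In particular $|\mathrm{Flat}_n(\sigma)|=|\mathrm{RGF}_n[\sigma^{ -1}]|$ for all $n$.
   Context: A Cayley permutation of length $n\ge 0$ is a word $x=x(1)\cdots x(n)$ of positive integers in which every integer from $1$ to $\max(x)$ occurs; permutations (one-line notation) are those without repeated letters; $\mathrm{id}_n=12\cdots n$, $\sigma^{ -1}$ is the inverse permutation. $x$ contains $y$ if some subsequence $x(i_1)\cdots x(i_k)$, $i_1<\cdots<i_k$, is order isomorphic to $y$ (same relative order and same equalities); otherwise $x$ avoids $y$. For a weakly increasing Cayley permutation $u$ and a Cayley permutation $v$ of the same length, the Burge transpose $(u,v)^T$ of the biword with columns $\binom{u(i)}{v(i)}$ is obtained by flipping each column and sorting the columns increasingly by top entry, ties broken by decreasing bottom entry. For $x$ of length $n$, $\gamma(x)$ is the bottom row of $(\mathrm{id}_n,x)^T$. Write $x\sim y$ iff $\gamma(x)=\gamma(y)$, and $[y]$ for the class of $y$. A restricted growth function is a Cayley permutation $x$ of length $n$ with $x(1)=1$ and $x(i+1)\le\max\{x(1),\dots,x(i)\}+1$ for $1\le i<n$; $\mathrm{RGF}$ ($\mathrm{RGF}_n$)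 is the set of these (of length $n$), and $\mathrm{RGF}[y]$ ($\mathrm{RGF}_n[y]$) is the set of those (of length $n$) avoiding every element of $[y]$. A permutation $\pi$ avoids the vincular pattern $23\text{ - }1$ if there are no indices $i$ and $k>i+1$ with $\pi(k)<\pi(i)<\pi(i+1)$. $\mathrm{Flat}=S(23\text{ - }1)$ is the set of permutations avoiding $23\text{ - }1$, and $\mathrm{Flat}(\sigma)$ ($\mathrm{Flat}_n(\sigma)$) the subset (of length $n$) avoiding $\sigma$. -}

module Defs where

open import Data.Nat using (ℕ; zero; suc; _≤_; _<_; _⊔_; _<ᵇ_; _≤ᵇ_; _≡ᵇ_)
open import Data.Bool using (Bool; true; false; _∧_; _∨_; if_then_else_)
open import Data.List using (List; []; _∷_; length; map; zip; upTo; lookup; foldr)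
open import Data.List.Membership.Propositional using (_∈_)
open import Data.List.Relation.Unary.Unique.Propositional using (Unique)
open import Data.List.Relation.Binary.Sublist.Propositional using (_⊆_)
open import Data.Fin using (Fin; toℕ; cast)
open import Data.Product using (Σ; _×_; _,_; proj₂; ∃-syntax)
open import Data.Unit using (⊤)
open import Relation.Binary.PropositionalEquality using (_≡_)
open import Relation.Nullary using (¬_)
open import Function.Bundles using (_⇔_)

maxL : List ℕ → ℕ
maxL = foldr _⊔_ 0

IsCayley : List ℕ → Set
IsCayley x = (∀ a → a ∈ x → 1 ≤ a) × (∀ k → 1 ≤ k → k ≤ maxL x → k ∈ x)

IsPerm : List ℕ → Set
IsPerm x = IsCayley x × Unique x

idL : ℕ → List ℕ
idL n = map suc (upTo n)

-- inverse permutation: σ⁻¹(v) = (1-based) position of v in σ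
indexOf : ℕ → List ℕ → ℕ
indexOf v [] = 0
indexOf v (a ∷ as) = if v ≡ᵇ a then 0 else suc (indexOf v as)

inv : List ℕ → List ℕ
inv σ = map (λ v → suc (indexOf v σ)) (idL (length σ))

colLeq : ℕ × ℕ → ℕ × ℕ → Bool
colLeq (a , b) (c , d) = (a <ᵇ c) ∨ ((a ≡ᵇ c) ∧ (d ≤ᵇ b))

insertCol : ℕ × ℕ → List (ℕ × ℕ) → List (ℕ × ℕ)
insertCol p [] = p ∷ []
insertCol p (q ∷ qs) = if colLeq p q then p ∷ q ∷ qs else q ∷ insertCol p qs

sortCols : List (ℕ × ℕ) → List (ℕ × ℕ)
sortCols = foldr insertCol []

flipCol : ℕ × ℕ → ℕ × ℕ
flipCol (a , b) = (b , a)

-- Burge transpose of a biword given as its list of columns (top , bottom)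
burgeT : List (ℕ × ℕ) → List (ℕ × ℕ)
burgeT cols = sortCols (map flipCol cols)

-- γ(x) = bottom row of (id_n , x)^T
γ : List ℕ → List ℕ
γ x = map proj₂ (burgeT (zip (idL (length x)) x))

OrderIso : List ℕ → List ℕ → Set
OrderIso s y = Σ (length s ≡ length y) λ eq → ∀ (i j : Fin (length s)) →
  ((lookup s i < lookup s j) ⇔ (lookup y (cast eq i) < lookup y (cast eq j))) ×
  ((lookup s i ≡ lookup s j) ⇔ (lookup y (cast eq i) ≡ lookup y (cast eq j)))

Contains : List ℕ → List ℕ → Set
Contains x y = ∃[ s ] (s ⊆ x × OrderIso s y)

Avoids : List ℕ → List ℕ → Set
Avoids x y = ¬ Contains x y

rgfFrom : ℕ → List ℕ → Set
rgfFrom m [] = ⊤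
rgfFrom m (a ∷ as) = (1 ≤ a) × (a ≤ suc m) × rgfFrom (m ⊔ a) as

IsRGF : List ℕ → Set
IsRGF x = IsCayley x × rgfFrom 0 x

-- x ∼ y  iff  γ x ≡ γ y ; [y] = Cayley permutations z with z ∼ y
InClass : List ℕ → List ℕ → Set
InClass z y = IsCayley z × (γ z ≡ γ y)

RGFAv : List ℕ → List ℕ → Set
RGFAv y x = IsRGF x × (∀ z → InClass z y → Avoids x z)

-- π contains the vincular pattern 23-1 (indices 0-based here: i, j = i+1, k > j)
Has23-1 : List ℕ → Set
Has23-1 π = ∃[ i ] ∃[ j ] ∃[ k ] ((toℕ j ≡ suc (toℕ i)) × (toℕ j < toℕ k) ×
  (lookup π k < lookup π i) × (lookup π i < lookup π j))

Flat : List ℕ → Set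
Flat π = IsPerm π × ¬ Has23-1 π

FlatAv : List ℕ → List ℕ → Set
FlatAv σ π = Flat π × Avoids π σ

HasCard : (List ℕ → Set) → ℕ → Set
HasCard P k = Σ (List (List ℕ)) λ L → Unique L × (∀ x → (x ∈ L) ⇔ P x) × (length L ≡ k)

-- γ x lists the positions 1..n of x by increasing value, ties by decreasing position: it is the
-- unique list of 1..n sorted by the key order Precedes x.  Hence an occurrence of z in x yields an
-- occurrence of γ z in γ x, and conversely an occurrence of γ y in γ x picks positions of x whose
-- standardisation z has γ z = γ y; so x avoids the class [y] iff γ x avoids γ y.
-- For an RGF x, the growth condition turns a 23-1 in γ x into a letter of γ x lying strictly between
-- two adjacent ones, and it forces two RGFs with the same key order to agree.  A flat π is γ of the
-- RGF whose letter at q is one more than the number of ascents of π before the position of q+1: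
-- ascent-free stretches of π descend, and flatness puts each ascent bottom below everything after it.
-- Finally γ(σ⁻¹) = σ, and the RGFs of length n form a finite decidable family that can be counted.

module Submission where

open import Defs
open import Data.Nat using (ℕ; zero; suc; _≤_; _<_; NonZero; >-nonZero; _⊔_; _≡ᵇ_; z≤n; s≤s; s≤s⁻¹; pred)
open import Data.Nat.Properties
open import Data.Bool using (true; false)
open import Data.List using (List; []; _∷_; _++_; length; map; zip; upTo; lookup; filter; applyUpTo; concatMap; deduplicate)
open import Data.List.Properties using (length-map; map-upTo; map-∘; length-applyUpTo; ≡-dec)
open import Data.List.Membership.Propositional using (_∈_; find; lose)
open import Data.List.Membership.Propositional.Properties
  using (∈-map⁺; ∈-map⁻; ∈-filter⁺; ∈-filter⁻; ∈-applyUpTo⁺; ∈-applyUpTo⁻; ∈-upTo⁺; ∈-upTo⁻;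
         ∈-++⁺ˡ; ∈-++⁺ʳ; ∈-++⁻; ∈-concatMap⁺; deduplicate-∈⇔)
open import Data.List.Relation.Unary.Any using (here; there; any?)
open import Data.List.Relation.Unary.All as All using (All; []; _∷_)
open import Data.List.Relation.Unary.AllPairs using (AllPairs; []; _∷_)
import Data.List.Relation.Unary.AllPairs as AllPairs
import Data.List.Relation.Unary.AllPairs.Properties as AllPairs
open import Data.List.Relation.Unary.Unique.Propositional using (Unique)
open import Data.List.Relation.Binary.Sublist.Propositional using (_⊆_; []; _∷_; _∷ʳ_)
open import Data.List.Relation.Binary.Sublist.Propositional.Properties using (Any-resp-⊆; filter-⊆; map⁺)
open import Data.List.Relation.Binary.Permutation.Propositional using (_↭_; ↭-refl; ↭-prep; ↭-swap; ↭-trans; ↭-sym)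
open import Data.List.Relation.Binary.Permutation.Propositional.Properties using (∈-resp-↭; All-resp-↭; ↭-length)
open import Data.List.Membership.Propositional.Properties.WithK using (unique∧set⇒bag)
open import Data.List.Relation.Binary.BagAndSetEquality using (∼bag⇒↭)
open import Data.List.Membership.DecPropositional _≟_ using (_∈?_)
open import Data.List.Relation.Unary.Unique.DecPropositional.Properties (≡-dec _≟_) using (deduplicate-!)
open import Data.Fin as Fin using (Fin; toℕ; cast; fromℕ<)
open import Data.Fin.Properties using (toℕ-cast; toℕ-fromℕ<; toℕ<n)
open import Data.Product as Product using (_×_; _,_; proj₁; proj₂; ∃-syntax)
open import Data.Sum as Sum using (_⊎_; inj₁; inj₂)
open import Data.Empty using (⊥; ⊥-elim)
open import Relation.Binary.PropositionalEquality
open import Relation.Nullary using (¬_; Dec; yes; no; ¬?)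
open import Relation.Nullary.Decidable using (map′; _×-dec_; _→-dec_)
open import Relation.Nullary.Reflects using (Reflects; ofʸ; ofⁿ; fromEquivalence; _⊎-reflects_; _×-reflects_)
open import Relation.Binary.Definitions using (tri<; tri≈; tri>)
open import Function.Base using (_∘_; case_of_)
open import Function.Bundles using (_⇔_; mk⇔; Equivalence)
open Equivalence using (to; from)
open import Function.Properties.Equivalence using () renaming (sym to ⇔-sym; trans to ⇔-trans)

-- 0-based; out-of-range positions read as 0.
at : List ℕ → ℕ → ℕ
at []       _       = 0
at (a ∷ as) zero    = a
at (a ∷ as) (suc p) = at as p

lookup≡at : ∀ xs (i : Fin (length xs)) → lookup xs i ≡ at xs (toℕ i)
lookup≡at (a ∷ xs) Fin.zero    = refl
lookup≡at (a ∷ xs) (Fin.suc i) = lookup≡at xs i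

at-∈ : ∀ xs {p} → p < length xs → at xs p ∈ xs
at-∈ (a ∷ xs) {zero}  _       = here refl
at-∈ (a ∷ xs) {suc p} (s≤s h) = there (at-∈ xs h)

∈⇒at : ∀ {a} xs → a ∈ xs → ∃[ p ] (p < length xs × at xs p ≡ a)
∈⇒at (b ∷ xs) (here refl) = 0 , s≤s z≤n , refl
∈⇒at (b ∷ xs) (there m) with ∈⇒at xs m
... | p , h , e = suc p , s≤s h , e

at-map : ∀ (f : ℕ → ℕ) xs {p} → p < length xs → at (map f xs) p ≡ f (at xs p)
at-map f (a ∷ xs) {zero}  _       = refl
at-map f (a ∷ xs) {suc p} (s≤s h) = at-map f xs h

at-applyUpTo : ∀ (f : ℕ → ℕ) n {p} → p < n → at (applyUpTo f n) p ≡ f p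
at-applyUpTo f (suc n) {zero}  _       = refl
at-applyUpTo f (suc n) {suc p} (s≤s h) = at-applyUpTo (λ k → f (suc k)) n h

applyUpTo-at : ∀ xs → applyUpTo (at xs) (length xs) ≡ xs
applyUpTo-at []       = refl
applyUpTo-at (a ∷ xs) = cong (a ∷_) (applyUpTo-at xs)

at-ext-by-prefix : ∀ xs ys → length xs ≡ length ys →
  (∀ p → p < length xs → (∀ q → q < p → at xs q ≡ at ys q) → at xs p ≡ at ys p) → xs ≡ ys
at-ext-by-prefix []       []       _  _    = refl
at-ext-by-prefix (a ∷ xs) (b ∷ ys) eq step = cong₂ _∷_ a≡b (at-ext-by-prefix xs ys (suc-injective eq) step′)
  where
  a≡b : a ≡ b
  a≡b = step 0 (s≤s z≤n) (λ _ ())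
  step′ : ∀ p → p < length xs → (∀ q → q < p → at xs q ≡ at ys q) → at xs p ≡ at ys p
  step′ p h prefix = step (suc p) (s≤s h) λ where
    zero    _       → a≡b
    (suc q) (s≤s q<p) → prefix q q<p

at-ext : ∀ xs ys → length xs ≡ length ys → (∀ p → p < length xs → at xs p ≡ at ys p) → xs ≡ ys
at-ext xs ys eq h = at-ext-by-prefix xs ys eq (λ p hp _ → h p hp)

All-at : ∀ {P : ℕ → Set} {xs} → All P xs → ∀ {p} → p < length xs → P (at xs p)
All-at (px ∷ _)   {zero}  _       = px
All-at (_  ∷ pxs) {suc p} (s≤s h) = All-at pxs h

AllPairs-at : ∀ {R : ℕ → ℕ → Set} {xs} → AllPairs R xs →
  ∀ {i j} → i < j → j < length xs → R (at xs i) (at xs j)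
AllPairs-at (px ∷ _)   {zero}  {suc j} _        (s≤s h) = All-at px h
AllPairs-at (_  ∷ pxs) {suc i} {suc j} (s≤s ij) (s≤s h) = AllPairs-at pxs ij h

at⇒AllPairs : ∀ {R : ℕ → ℕ → Set} xs →
  (∀ {i j} → i < j → j < length xs → R (at xs i) (at xs j)) → AllPairs R xs
at⇒AllPairs []       _ = []
at⇒AllPairs {R} (a ∷ xs) h = All.tabulate head ∷ at⇒AllPairs xs (λ ij jl → h (s≤s ij) (s≤s jl))
  where
  head : ∀ {b} → b ∈ xs → R a b
  head m with ∈⇒at xs m
  ... | p , hp , refl = h (s≤s z≤n) (s≤s hp)

≡ᵇ-reflects-≡ : ∀ m n → Reflects (m ≡ n) (m ≡ᵇ n)
≡ᵇ-reflects-≡ m n = fromEquivalence (≡ᵇ⇒≡ m n) (≡⇒≡ᵇ m n)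

indexOf-at : ∀ {a} xs → a ∈ xs → indexOf a xs < length xs × at xs (indexOf a xs) ≡ a
indexOf-at {a} (b ∷ xs) m with a ≡ᵇ b | ≡ᵇ-reflects-≡ a b | m
... | true  | ofʸ refl | _       = s≤s z≤n , refl
... | false | ofⁿ a≢b  | here e  = ⊥-elim (a≢b e)
... | false | ofⁿ _    | there m′ with indexOf-at xs m′
...   | h , e = s≤s h , e

at-indexOf : ∀ xs → Unique xs → ∀ {p} → p < length xs → indexOf (at xs p) xs ≡ p
at-indexOf (b ∷ xs) _ {zero} _ with b ≡ᵇ b | ≡ᵇ-reflects-≡ b b
... | true  | _       = refl
... | false | ofⁿ b≢b = ⊥-elim (b≢b refl)
at-indexOf (b ∷ xs) (b∉xs ∷ u) {suc p} (s≤s h) with at xs p ≡ᵇ b | ≡ᵇ-reflects-≡ (at xs p) b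
... | true  | ofʸ e = ⊥-elim (All-at b∉xs h (sym e))
... | false | _     = cong suc (at-indexOf xs u h)

at-injective : ∀ xs → Unique xs → ∀ {i j} → i < length xs → j < length xs → at xs i ≡ at xs j → i ≡ j
at-injective xs u hi hj e =
  trans (sym (at-indexOf xs u hi)) (trans (cong (λ w → indexOf w xs) e) (at-indexOf xs u hj))

AllPairs-map-on : ∀ {A : Set} {P : A → Set} {R S : A → A → Set} →
  (∀ {a b} → P a → P b → R a b → S a b) → ∀ {xs} → All P xs → AllPairs R xs → AllPairs S xs
AllPairs-map-on f []         []         = []
AllPairs-map-on f (pa ∷ pas) (ra ∷ ras) =
  All.zipWith (λ (pb , r) → f pa pb r) (pas , ra) ∷ AllPairs-map-on f pas ras

AllPairs-resp-⊆ : ∀ {A : Set} {R : A → A → Set} {xs ys} → xs ⊆ ys → AllPairs R ys → AllPairs R xs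
AllPairs-resp-⊆ []        []         = []
AllPairs-resp-⊆ (_ ∷ʳ p)  (_ ∷ rys)  = AllPairs-resp-⊆ p rys
AllPairs-resp-⊆ (refl ∷ p) (ra ∷ rys) = All.tabulate (λ m → All.lookup ra (Any-resp-⊆ p m)) ∷ AllPairs-resp-⊆ p rys

module _ {A : Set} {R : A → A → Set} (asym : ∀ {a b} → R a b → ¬ R b a) where

  asym-sorted⇒Unique : ∀ {xs} → AllPairs R xs → Unique xs
  asym-sorted⇒Unique = AllPairs.map λ { r refl → asym r r }

  private
    sorted-heads : ∀ {a b L₁ L₂} → All (R a) L₁ → All (R b) L₂ → a ∈ b ∷ L₂ → b ∈ a ∷ L₁ → a ≡ b
    sorted-heads _  _  (here e)  _          = e
    sorted-heads _  _  (there _) (here e)   = sym e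
    sorted-heads ra rb (there m) (there m′) = ⊥-elim (asym (All.lookup ra m′) (All.lookup rb m))

    drop-head : ∀ {a c L₁ L₂} → All (R a) L₁ → (c ∈ a ∷ L₁ → c ∈ a ∷ L₂) → c ∈ L₁ → c ∈ L₂
    drop-head ra f m with f (there m)
    ... | here refl = ⊥-elim (asym (All.lookup ra m) (All.lookup ra m))
    ... | there m′  = m′

  sorted-unique : ∀ {L₁ L₂} → AllPairs R L₁ → AllPairs R L₂ →
    (∀ {a} → a ∈ L₁ → a ∈ L₂) → (∀ {a} → a ∈ L₂ → a ∈ L₁) → L₁ ≡ L₂
  sorted-unique []        []        _ _ = refl
  sorted-unique []        (_ ∷ _)   _ g with g (here refl)
  ... | ()
  sorted-unique (_ ∷ _)   []        f _ with f (here refl)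
  ... | ()
  sorted-unique (ra ∷ s₁) (rb ∷ s₂) f g with sorted-heads ra rb (f (here refl)) (g (here refl))
  ... | refl = cong (_ ∷_) (sorted-unique s₁ s₂ (drop-head ra f) (drop-head rb g))

  sorted-transfer : ∀ {S : A → A → Set} {L} → AllPairs R L → AllPairs S L →
    ∀ {a b} → a ∈ L → b ∈ L → R a b → S a b
  sorted-transfer (ra ∷ _)  (_  ∷ _)  (here refl) (here refl) r = ⊥-elim (asym r r)
  sorted-transfer (_  ∷ _)  (sa ∷ _)  (here refl) (there mb)  _ = All.lookup sa mb
  sorted-transfer (ra ∷ _)  (_  ∷ _)  (there ma)  (here refl) r = ⊥-elim (asym r (All.lookup ra ma))
  sorted-transfer (_  ∷ rs) (_  ∷ ss) (there ma)  (there mb)  r = sorted-transfer rs ss ma mb r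

upTo-sorted : ∀ n → AllPairs _<_ (upTo n)
upTo-sorted n = AllPairs.applyUpTo⁺₁ (λ i → i) n (λ i<j _ → i<j)

module _ {R : ℕ → ℕ → Set} (asym : ∀ {a b} → R a b → ¬ R b a) where

  sorted-⊆ : ∀ {L I} → AllPairs R L → AllPairs R I → (∀ {a} → a ∈ I → a ∈ L) → I ⊆ L
  sorted-⊆ {L} {I} sL sI I⊆L = subst (_⊆ L) filter≡I (filter-⊆ (_∈? I) L)
    where
    filter≡I : filter (_∈? I) L ≡ I
    filter≡I = sorted-unique asym (AllPairs.filter⁺ (_∈? I) sL) sI
      (λ m → proj₂ (∈-filter⁻ (_∈? I) {xs = L} m)) (λ m → ∈-filter⁺ (_∈? I) (I⊆L m) m)

  sorted-no-between-adjacent : ∀ {L} → AllPairs R L → ∀ {r d} → suc r < length L → d ∈ L →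
    R (at L r) d → R d (at L (suc r)) → ⊥
  sorted-no-between-adjacent (_ ∷ _)       {zero} _ (here refl)         r _ = asym r r
  sorted-no-between-adjacent (_ ∷ _)       {zero} _ (there (here refl)) _ r = asym r r
  sorted-no-between-adjacent (_ ∷ rb ∷ _)  {zero} _ (there (there m))   _ r = asym r (All.lookup rb m)
  sorted-no-between-adjacent (ra ∷ _) {suc i} (s≤s h) (here refl) r _ =
    asym r (All-at ra (<-trans ≤-refl h))
  sorted-no-between-adjacent (_ ∷ s) {suc i} (s≤s h) (there m) r r′ = sorted-no-between-adjacent s h m r r′

-- The column order and γ

_≤ᶜ_ _<ᶜ_ : ℕ × ℕ → ℕ × ℕ → Set
(u , a) ≤ᶜ (v , b) = u < v ⊎ (u ≡ v × b ≤ a)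
(u , a) <ᶜ (v , b) = u < v ⊎ (u ≡ v × b < a)

colLeq-reflects : ∀ c d → Reflects (c ≤ᶜ d) (colLeq c d)
colLeq-reflects (u , a) (v , b) = <ᵇ-reflects-< u v ⊎-reflects (≡ᵇ-reflects-≡ u v ×-reflects ≤ᵇ-reflects-≤ b a)

<ᶜ-asym : ∀ {c d} → c <ᶜ d → ¬ d <ᶜ c
<ᶜ-asym (inj₁ p)       (inj₁ q)       = <-asym p q
<ᶜ-asym (inj₁ p)       (inj₂ (e , _)) = <-irrefl (sym e) p
<ᶜ-asym (inj₂ (e , _)) (inj₁ q)       = <-irrefl (sym e) q
<ᶜ-asym (inj₂ (_ , p)) (inj₂ (_ , q)) = <-asym p q

<ᶜ-trans : ∀ {c d e} → c <ᶜ d → d <ᶜ e → c <ᶜ e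
<ᶜ-trans (inj₁ p)          (inj₁ q)          = inj₁ (<-trans p q)
<ᶜ-trans (inj₁ p)          (inj₂ (refl , _)) = inj₁ p
<ᶜ-trans (inj₂ (refl , _)) (inj₁ q)          = inj₁ q
<ᶜ-trans (inj₂ (refl , p)) (inj₂ (refl , q)) = inj₂ (refl , <-trans q p)

≤ᶜ∧≢⇒<ᶜ : ∀ {c d} → c ≤ᶜ d → proj₂ c ≢ proj₂ d → c <ᶜ d
≤ᶜ∧≢⇒<ᶜ (inj₁ p)        _  = inj₁ p
≤ᶜ∧≢⇒<ᶜ (inj₂ (e , le)) ne = inj₂ (e , ≤∧≢⇒< le (ne ∘ sym))

≰ᶜ⇒>ᶜ : ∀ {c d} → ¬ c ≤ᶜ d → d <ᶜ c
≰ᶜ⇒>ᶜ {u , a} {v , b} c≰d with <-cmp u v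
... | tri< u<v _ _ = ⊥-elim (c≰d (inj₁ u<v))
... | tri> _ _ v<u = inj₁ v<u
... | tri≈ _ u≡v _ with ≤-total b a
...   | inj₁ b≤a = ⊥-elim (c≰d (inj₂ (u≡v , b≤a)))
...   | inj₂ a≤b = inj₂ (sym u≡v , ≤∧≢⇒< a≤b λ { refl → c≰d (inj₂ (u≡v , ≤-refl)) })

insertCol-↭ : ∀ p L → insertCol p L ↭ p ∷ L
insertCol-↭ p []       = ↭-refl
insertCol-↭ p (q ∷ qs) with colLeq p q
... | true  = ↭-refl
... | false = ↭-trans (↭-prep q (insertCol-↭ p qs)) (↭-swap q p ↭-refl)

sortCols-↭ : ∀ L → sortCols L ↭ L
sortCols-↭ []      = ↭-refl
sortCols-↭ (p ∷ L) = ↭-trans (insertCol-↭ p (sortCols L)) (↭-prep p (sortCols-↭ L))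

DistinctBottoms : ℕ × ℕ → ℕ × ℕ → Set
DistinctBottoms c d = proj₂ c ≢ proj₂ d

insertCol-sorted : ∀ p L → All (DistinctBottoms p) L → AllPairs _<ᶜ_ L → AllPairs _<ᶜ_ (insertCol p L)
insertCol-sorted p []       _        _          = [] ∷ []
insertCol-sorted p (q ∷ qs) (d ∷ ds) (sq ∷ sqs) with colLeq p q | colLeq-reflects p q
... | true  | ofʸ p≤q = (p<q ∷ All.map (<ᶜ-trans p<q) sq) ∷ sq ∷ sqs
  where p<q = ≤ᶜ∧≢⇒<ᶜ p≤q d
... | false | ofⁿ p≰q =
  All-resp-↭ (↭-sym (insertCol-↭ p qs)) (≰ᶜ⇒>ᶜ p≰q ∷ sq) ∷ insertCol-sorted p qs ds sqs

sortCols-sorted : ∀ L → AllPairs DistinctBottoms L → AllPairs _<ᶜ_ (sortCols L)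
sortCols-sorted []      _        = []
sortCols-sorted (p ∷ L) (d ∷ ds) =
  insertCol-sorted p (sortCols L) (All-resp-↭ (↭-sym (sortCols-↭ L)) d) (sortCols-sorted L ds)

-- key x a is the flipped column (x(a) , a) of the biword (id , x), for 1-based a.
key : List ℕ → ℕ → ℕ × ℕ
key x a = at x (pred a) , a

columns : List ℕ → List (ℕ × ℕ)
columns x = applyUpTo (λ i → key x (suc i)) (length x)

flip-zip : ∀ (g : ℕ → ℕ) x →
  map flipCol (zip (applyUpTo g (length x)) x) ≡ applyUpTo (λ i → at x i , g i) (length x)
flip-zip g []      = refl
flip-zip g (a ∷ x) = cong ((a , g 0) ∷_) (flip-zip (g ∘ suc) x)

γ≡sorted-columns : ∀ x → γ x ≡ map proj₂ (sortCols (columns x))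
γ≡sorted-columns x = cong (map proj₂ ∘ sortCols)
  (trans (cong (λ L → map flipCol (zip L x)) (map-upTo suc (length x))) (flip-zip suc x))

InRange : ℕ → ℕ → Set
InRange n a = 1 ≤ a × a ≤ n

Precedes : List ℕ → ℕ → ℕ → Set
Precedes x a b = key x a <ᶜ key x b

Precedes-asym : ∀ x {a b} → Precedes x a b → ¬ Precedes x b a
Precedes-asym x = <ᶜ-asym

Precedes⇒≤ : ∀ x {a b} → Precedes x a b → at x (pred a) ≤ at x (pred b)
Precedes⇒≤ x (inj₁ lt)      = <⇒≤ lt
Precedes⇒≤ x (inj₂ (e , _)) = ≤-reflexive e

Precedes∧<⇒< : ∀ x {a b} → Precedes x a b → a < b → at x (pred a) < at x (pred b)
Precedes∧<⇒< x (inj₁ lt)        _   = lt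
Precedes∧<⇒< x (inj₂ (_ , b<a)) a<b = ⊥-elim (<-asym b<a a<b)

∈-columns⁻ : ∀ x {c} → c ∈ columns x → ∃[ a ] (InRange (length x) a × c ≡ key x a)
∈-columns⁻ x m with ∈-applyUpTo⁻ _ m
... | i , h , refl = suc i , (s≤s z≤n , h) , refl

∈-columns⁺ : ∀ x {a} → InRange (length x) a → key x a ∈ columns x
∈-columns⁺ x {suc i} (_ , h) = ∈-applyUpTo⁺ _ h

∈-γ⁻ : ∀ x {a} → a ∈ γ x → InRange (length x) a
∈-γ⁻ x m with ∈-map⁻ proj₂ (subst (_ ∈_) (γ≡sorted-columns x) m)
... | c , mc , refl with ∈-columns⁻ x (∈-resp-↭ (sortCols-↭ (columns x)) mc)
...   | a , r , refl = r

∈-γ⁺ : ∀ x {a} → InRange (length x) a → a ∈ γ x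
∈-γ⁺ x r = subst (_ ∈_) (sym (γ≡sorted-columns x))
  (∈-map⁺ proj₂ (∈-resp-↭ (↭-sym (sortCols-↭ (columns x))) (∈-columns⁺ x r)))

length-γ : ∀ x → length (γ x) ≡ length x
length-γ x = begin
  length (γ x)                                ≡⟨ cong length (γ≡sorted-columns x) ⟩
  length (map proj₂ (sortCols (columns x)))   ≡⟨ length-map proj₂ (sortCols (columns x)) ⟩
  length (sortCols (columns x))               ≡⟨ ↭-length (sortCols-↭ (columns x)) ⟩
  length (columns x)                          ≡⟨ length-applyUpTo _ (length x) ⟩
  length x                                    ∎
  where open ≡-Reasoning

γ-sorted : ∀ x → AllPairs (Precedes x) (γ x)
γ-sorted x = subst (AllPairs (Precedes x)) (sym (γ≡sorted-columns x))
  (AllPairs.map⁺ (AllPairs-map-on (subst₂ _<ᶜ_) areKeys sorted))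
  where
  sorted : AllPairs _<ᶜ_ (sortCols (columns x))
  sorted = sortCols-sorted (columns x)
    (AllPairs.applyUpTo⁺₁ _ (length x) λ i<j _ e → <-irrefl (suc-injective e) i<j)
  areKeys : All (λ c → c ≡ key x (proj₂ c)) (sortCols (columns x))
  areKeys = All.tabulate λ m → case ∈-columns⁻ x (∈-resp-↭ (sortCols-↭ (columns x)) m) of λ where
    (_ , _ , refl) → refl

γ-unique : ∀ x L → AllPairs (Precedes x) L →
  (∀ {a} → a ∈ L → InRange (length x) a) → (∀ {a} → InRange (length x) a → a ∈ L) → γ x ≡ L
γ-unique x L sorted range⁻ range⁺ =
  sorted-unique (Precedes-asym x) (γ-sorted x) sorted (range⁺ ∘ ∈-γ⁻ x) (∈-γ⁺ x ∘ range⁻)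

SameComparison : ℕ → ℕ → ℕ → ℕ → Set
SameComparison a b c d = ((a < b) ⇔ (c < d)) × ((a ≡ b) ⇔ (c ≡ d))

SameComparison-sym : ∀ {a b c d} → SameComparison a b c d → SameComparison c d a b
SameComparison-sym (lt , eq) = ⇔-sym lt , ⇔-sym eq

SameComparison-resp : ∀ {a b c d a′ b′ c′ d′} → a ≡ a′ → b ≡ b′ → c ≡ c′ → d ≡ d′ →
  SameComparison a b c d → SameComparison a′ b′ c′ d′
SameComparison-resp refl refl refl refl sc = sc

IncreasingOn : (ℕ → Set) → (ℕ → ℕ) → Set
IncreasingOn P f = ∀ {a b} → P a → P b → a < b → f a < f b

increasing⇒SameComparison : ∀ {P f} → IncreasingOn P f → ∀ {a b} → P a → P b → SameComparison (f a) (f b) a b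
increasing⇒SameComparison {f = f} inc {a} {b} pa pb with <-cmp a b
... | tri< a<b _ _ = mk⇔ (λ _ → a<b) (λ _ → inc pa pb a<b) ,
                     mk⇔ (λ e → ⊥-elim (<-irrefl e (inc pa pb a<b))) (λ e → ⊥-elim (<-irrefl e a<b))
... | tri≈ _ refl _ = mk⇔ (⊥-elim ∘ <-irrefl refl) (⊥-elim ∘ <-irrefl refl) , mk⇔ (λ _ → refl) (λ _ → refl)
... | tri> _ _ b<a = mk⇔ (λ lt → ⊥-elim (<-asym lt (inc pb pa b<a))) (λ lt → ⊥-elim (<-asym lt b<a)) ,
                     mk⇔ (λ e → ⊥-elim (<-irrefl (sym e) (inc pb pa b<a))) (λ e → ⊥-elim (<-irrefl (sym e) b<a))

OrderIsoAt : List ℕ → List ℕ → Set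
OrderIsoAt s y = length s ≡ length y ×
  (∀ {i} → i < length s → ∀ {j} → j < length s → SameComparison (at s i) (at s j) (at y i) (at y j))

OrderIso⇔OrderIsoAt : ∀ s y → OrderIso s y ⇔ OrderIsoAt s y
OrderIso⇔OrderIsoAt s y = mk⇔
  (λ (eq , iso) → eq , λ hi hj → SameComparison-resp (atˢ hi) (atˢ hj) (atʸ eq hi) (atʸ eq hj)
                                    (iso (fromℕ< hi) (fromℕ< hj)))
  (λ (eq , iso) → eq , λ i j → SameComparison-resp (sym (lookup≡at s i)) (sym (lookup≡at s j))
                                  (sym (atʸ′ eq i)) (sym (atʸ′ eq j)) (iso (toℕ<n i) (toℕ<n j)))
  where
  atˢ : ∀ {i} (h : i < length s) → lookup s (fromℕ< h) ≡ at s i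
  atˢ h = trans (lookup≡at s _) (cong (at s) (toℕ-fromℕ< h))
  atʸ′ : ∀ eq i → lookup y (cast eq i) ≡ at y (toℕ i)
  atʸ′ eq i = trans (lookup≡at y _) (cong (at y) (toℕ-cast eq i))
  atʸ : ∀ eq {i} (h : i < length s) → lookup y (cast eq (fromℕ< h)) ≡ at y i
  atʸ eq h = trans (atʸ′ eq _) (cong (at y) (toℕ-fromℕ< h))

map-OrderIsoAt : ∀ {P f} → IncreasingOn P f → ∀ {L} → All P L → OrderIsoAt (map f L) L
map-OrderIsoAt {f = f} inc {L} pL = length-map f L , λ hi hj →
  SameComparison-resp (sym (at-map f L (toL hi))) (sym (at-map f L (toL hj))) refl refl
    (increasing⇒SameComparison inc (All-at pL (toL hi)) (All-at pL (toL hj)))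
  where
  toL : ∀ {i} → i < length (map f L) → i < length L
  toL = subst (_ <_) (length-map f L)

partner : List ℕ → List ℕ → ℕ → ℕ
partner T L a = at T (indexOf a L)

OrderIsoAt⇒≡map-partner : ∀ T L → OrderIsoAt T L → Unique L → T ≡ map (partner T L) L
OrderIsoAt⇒≡map-partner T L (eq , _) u = at-ext T (map (partner T L) L) (trans eq (sym (length-map _ L)))
  λ p h → let h′ = subst (p <_) eq h in
    sym (trans (at-map (partner T L) L h′) (cong (at T) (at-indexOf L u h′)))

partner-increasing : ∀ T L → OrderIsoAt T L → IncreasingOn (_∈ L) (partner T L)
partner-increasing T L (eq , iso) {a} {b} ma mb a<b =
  from (proj₁ (iso (toT ma) (toT mb))) (subst₂ _<_ (sym (proj₂ (indexOf-at L ma))) (sym (proj₂ (indexOf-at L mb))) a<b)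
  where
  toT : ∀ {c} → c ∈ L → indexOf c L < length T
  toT mc = subst (_ <_) (sym eq) (proj₁ (indexOf-at L mc))

upTo-suc : ∀ n → upTo (suc n) ≡ 0 ∷ map suc (upTo n)
upTo-suc n = cong (0 ∷_) (sym (map-upTo suc n))

⊆⇒positions : ∀ {s x} → s ⊆ x → ∃[ ps ] (ps ⊆ upTo (length x) × map (at x) ps ≡ s)
⊆⇒positions [] = [] , [] , refl
⊆⇒positions {x = a ∷ x} (_ ∷ʳ sub) with ⊆⇒positions sub
... | ps , ps⊆ , refl = map suc ps , subst (map suc ps ⊆_) (sym (upTo-suc (length x))) (0 ∷ʳ map⁺ suc ps⊆) ,
  sym (map-∘ ps)
⊆⇒positions {x = a ∷ x} (refl ∷ sub) with ⊆⇒positions sub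
... | ps , ps⊆ , refl = 0 ∷ map suc ps , subst (0 ∷ map suc ps ⊆_) (sym (upTo-suc (length x))) (refl ∷ map⁺ suc ps⊆) ,
  cong (a ∷_) (sym (map-∘ ps))

positions⇒⊆ : ∀ x {ps} → ps ⊆ upTo (length x) → map (at x) ps ⊆ x
positions⇒⊆ x {ps} ps⊆ = subst (map (at x) ps ⊆_) (trans (map-upTo (at x) (length x)) (applyUpTo-at x)) (map⁺ (at x) ps⊆)

-- a and lift ps a are 1-based positions, the entries of ps are 0-based positions.
lift : List ℕ → ℕ → ℕ
lift ps a = suc (at ps (pred a))

Precedes-⇔ : ∀ z x {a b a′ b′} →
  SameComparison (at z (pred a)) (at z (pred b)) (at x (pred a′)) (at x (pred b′)) →
  ((b < a) ⇔ (b′ < a′)) → Precedes z a b ⇔ Precedes x a′ b′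
Precedes-⇔ z x (lt , eq) desc = mk⇔
  (Sum.map (to lt) (Product.map (to eq) (to desc)))
  (Sum.map (from lt) (Product.map (from eq) (from desc)))

suc-<⇔ : ∀ {m n} → (suc m < suc n) ⇔ (m < n)
suc-<⇔ = mk⇔ s≤s⁻¹ s≤s

occurrence-Precedes : ∀ x z {ps} → AllPairs _<_ ps → OrderIsoAt (map (at x) ps) z →
  ∀ {a b} → InRange (length z) a → InRange (length z) b → Precedes z a b ⇔ Precedes x (lift ps a) (lift ps b)
occurrence-Precedes x z {ps} sorted (eq , iso) {suc i} {suc j} (_ , hi) (_ , hj) =
  Precedes-⇔ z x sameValues
    (⇔-trans suc-<⇔ (⇔-trans (⇔-sym (proj₁ (increasing⇒SameComparison increasing (toPs hj) (toPs hi)))) (⇔-sym suc-<⇔)))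
  where
  toS : ∀ {k} → k < length z → k < length (map (at x) ps)
  toS = subst (_ <_) (sym eq)
  toPs : ∀ {k} → k < length z → k < length ps
  toPs = subst (_ <_) (length-map (at x) ps) ∘ toS
  increasing : IncreasingOn (_< length ps) (at ps)
  increasing _ hj i<j = AllPairs-at sorted i<j hj
  sameValues : SameComparison (at z i) (at z j) (at x (at ps i)) (at x (at ps j))
  sameValues = SameComparison-resp refl refl (at-map (at x) ps (toPs hi)) (at-map (at x) ps (toPs hj))
    (SameComparison-sym (iso (toS hi) (toS hj)))

-- Standardisation

∈⇒≤maxL : ∀ {a} xs → a ∈ xs → a ≤ maxL xs
∈⇒≤maxL (b ∷ xs) (here refl) = m≤m⊔n b (maxL xs)
∈⇒≤maxL (b ∷ xs) (there m)   = ≤-trans (∈⇒≤maxL xs m) (m≤n⊔m b (maxL xs))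

maxL-≤ : ∀ {B} xs → All (_≤ B) xs → maxL xs ≤ B
maxL-≤ []       []       = z≤n
maxL-≤ (b ∷ xs) (p ∷ ps) = ⊔-lub p (maxL-≤ xs ps)

values : List ℕ → List ℕ
values s = filter (_∈? s) (upTo (suc (maxL s)))

∈-values⁻ : ∀ s {v} → v ∈ values s → v ∈ s
∈-values⁻ s m = proj₂ (∈-filter⁻ (_∈? s) {xs = upTo (suc (maxL s))} m)

∈-values⁺ : ∀ s {v} → v ∈ s → v ∈ values s
∈-values⁺ s m = ∈-filter⁺ (_∈? s) (∈-upTo⁺ (s≤s (∈⇒≤maxL s m))) m

values-sorted : ∀ s → AllPairs _<_ (values s)
values-sorted s = AllPairs.filter⁺ (_∈? s) (upTo-sorted (suc (maxL s)))

rank : List ℕ → ℕ → ℕ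
rank s v = suc (indexOf v (values s))

std : List ℕ → List ℕ
std s = map (rank s) s

SameComparison-suc : ∀ {a b c d} → SameComparison a b c d → SameComparison a b (suc c) (suc d)
SameComparison-suc (lt , eq) = ⇔-trans lt (⇔-sym suc-<⇔) , ⇔-trans eq (mk⇔ (cong suc) suc-injective)

rank-SameComparison : ∀ s {a b} → a ∈ s → b ∈ s → SameComparison a b (rank s a) (rank s b)
rank-SameComparison s ma mb = SameComparison-suc (SameComparison-resp atᵃ atᵇ refl refl
  (increasing⇒SameComparison (λ _ hj i<j → AllPairs-at (values-sorted s) i<j hj)
    (proj₁ (indexOf-at V ma′)) (proj₁ (indexOf-at V mb′))))
  where
  V = values s
  ma′ = ∈-values⁺ s ma
  mb′ = ∈-values⁺ s mb
  atᵃ = proj₂ (indexOf-at V ma′)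
  atᵇ = proj₂ (indexOf-at V mb′)

std-OrderIsoAt : ∀ s → OrderIsoAt s (std s)
std-OrderIsoAt s = sym (length-map (rank s) s) , λ hi hj →
  SameComparison-resp refl refl (sym (at-map (rank s) s hi)) (sym (at-map (rank s) s hj))
    (rank-SameComparison s (at-∈ s hi) (at-∈ s hj))

std-Cayley : ∀ s → IsCayley (std s)
std-Cayley s = positive , dense
  where
  V = values s
  positive : ∀ a → a ∈ std s → 1 ≤ a
  positive a m with ∈-map⁻ (rank s) m
  ... | _ , _ , refl = s≤s z≤n
  bounded : maxL (std s) ≤ length V
  bounded = maxL-≤ (std s) (All.tabulate λ m → case ∈-map⁻ (rank s) m of λ where
    (_ , mv , refl) → proj₁ (indexOf-at V (∈-values⁺ s mv)))
  dense : ∀ k → 1 ≤ k → k ≤ maxL (std s) → k ∈ std s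
  dense (suc k) _ k≤max = subst (_∈ std s) (cong suc (at-indexOf V (asym-sorted⇒Unique <-asym (values-sorted s)) k<))
    (∈-map⁺ (rank s) (∈-values⁻ s (at-∈ V k<)))
    where
    k< : k < length V
    k< = ≤-trans k≤max bounded

-- γ and pattern containment

γ-preserves-containment : ∀ x z → Contains x z → Contains (γ x) (γ z)
γ-preserves-containment x z (s , s⊆x , iso) with ⊆⇒positions s⊆x
... | ps , ps⊆ , refl = I , I⊆γx , from (OrderIso⇔OrderIsoAt I (γ z)) (map-OrderIsoAt lift-increasing γz-range)
  where
  occurrence : OrderIsoAt (map (at x) ps) z
  occurrence = to (OrderIso⇔OrderIsoAt (map (at x) ps) z) iso
  toPs : ∀ {k} → k < length z → k < length ps
  toPs = subst (_ <_) (trans (sym (proj₁ occurrence)) (length-map (at x) ps))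
  ps-sorted : AllPairs _<_ ps
  ps-sorted = AllPairs-resp-⊆ ps⊆ (upTo-sorted (length x))
  lift-increasing : IncreasingOn (InRange (length z)) (lift ps)
  lift-increasing {suc i} {suc j} _ (_ , hj) (s≤s i<j) = s≤s (AllPairs-at ps-sorted i<j (toPs hj))
  lift-range : ∀ {a} → InRange (length z) a → InRange (length x) (lift ps a)
  lift-range {suc i} (_ , hi) = s≤s z≤n , ∈-upTo⁻ (Any-resp-⊆ ps⊆ (at-∈ ps (toPs hi)))
  γz-range : All (InRange (length z)) (γ z)
  γz-range = All.tabulate (∈-γ⁻ z)
  I : List ℕ
  I = map (lift ps) (γ z)
  I-sorted : AllPairs (Precedes x) I
  I-sorted = AllPairs.map⁺ (AllPairs-map-on (λ ra rb → to (occurrence-Precedes x z ps-sorted occurrence ra rb))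
    γz-range (γ-sorted z))
  I⊆γx : I ⊆ γ x
  I⊆γx = sorted-⊆ (Precedes-asym x) (γ-sorted x) I-sorted λ m → case ∈-map⁻ (lift ps) m of λ where
    (_ , ma , refl) → ∈-γ⁺ x (lift-range (∈-γ⁻ z ma))

γ-occurrence⇒increasing : ∀ x y → Contains (γ x) (γ y) → ∃[ g ]
  (IncreasingOn (InRange (length y)) g × (∀ {a} → InRange (length y) a → InRange (length x) (g a)) ×
   AllPairs (λ a b → Precedes x (g a) (g b)) (γ y))
γ-occurrence⇒increasing x y (T , T⊆γx , iso) = g , increasing , range , AllPairs.map⁻ sorted
  where
  g = partner T (γ y)
  occurrence : OrderIsoAt T (γ y)
  occurrence = to (OrderIso⇔OrderIsoAt T (γ y)) iso
  T≡ : T ≡ map g (γ y)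
  T≡ = OrderIsoAt⇒≡map-partner T (γ y) occurrence (asym-sorted⇒Unique (Precedes-asym y) (γ-sorted y))
  increasing : IncreasingOn (InRange (length y)) g
  increasing ra rb = partner-increasing T (γ y) occurrence (∈-γ⁺ y ra) (∈-γ⁺ y rb)
  range : ∀ {a} → InRange (length y) a → InRange (length x) (g a)
  range {a} r = ∈-γ⁻ x (Any-resp-⊆ T⊆γx (subst (g a ∈_) (sym T≡) (∈-map⁺ g (∈-γ⁺ y r))))
  sorted : AllPairs (Precedes x) (map g (γ y))
  sorted = subst (AllPairs (Precedes x)) T≡ (AllPairs-resp-⊆ T⊆γx (γ-sorted x))

increasing⇒lift : ∀ {m n g} → IncreasingOn (InRange m) g → (∀ {a} → InRange m a → InRange n (g a)) →
  ∃[ ps ] (ps ⊆ upTo n × AllPairs _<_ ps × length ps ≡ m × (∀ {a} → InRange m a → lift ps a ≡ g a))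
increasing⇒lift {m} {n} {g} increasing range = ps , ps⊆ , sorted , length-applyUpTo _ m , lift≡g
  where
  ps : List ℕ
  ps = applyUpTo (λ i → pred (g (suc i))) m
  nonZero : ∀ {i} → i < m → NonZero (g (suc i))
  nonZero i<m = >-nonZero (proj₁ (range (s≤s z≤n , i<m)))
  sorted : AllPairs _<_ ps
  sorted = AllPairs.applyUpTo⁺₁ _ m λ i<j j<m →
    pred-mono-< {{nonZero (<-trans i<j j<m)}} (increasing (s≤s z≤n , <-trans i<j j<m) (s≤s z≤n , j<m) (s≤s i<j))
  ps⊆ : ps ⊆ upTo n
  ps⊆ = sorted-⊆ <-asym (upTo-sorted n) sorted λ p∈ps → case ∈-applyUpTo⁻ _ p∈ps of λ where
    (i , i<m , refl) → ∈-upTo⁺ (pred-mono-< {{nonZero i<m}} (s≤s (proj₂ (range (s≤s z≤n , i<m)))))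
  lift≡g : ∀ {a} → InRange m a → lift ps a ≡ g a
  lift≡g {suc i} (_ , i<m) = trans (cong suc (at-applyUpTo _ m i<m)) (suc-pred (g (suc i)) {{nonZero i<m}})

γ-reflects-containment : ∀ x y → Contains (γ x) (γ y) → ∃[ z ] (InClass z y × Contains x z)
γ-reflects-containment x y γx⊇γy with γ-occurrence⇒increasing x y γx⊇γy
... | g , increasing , range , g-sorted with increasing⇒lift increasing range
...   | ps , ps⊆ , ps-sorted , length-ps , lift≡g =
  std s , (std-Cayley s , γz≡γy) , s , positions⇒⊆ x ps⊆ , from (OrderIso⇔OrderIsoAt s (std s)) (std-OrderIsoAt s)
  where
  s = map (at x) ps
  length-std : length (std s) ≡ length y
  length-std = trans (length-map (rank s) s) (trans (length-map (at x) ps) length-ps)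
  toStd : ∀ {a} → InRange (length y) a → InRange (length (std s)) a
  toStd = subst (λ n → InRange n _) (sym length-std)
  sorted : AllPairs (Precedes (std s)) (γ y)
  sorted = AllPairs-map-on
    (λ ra rb prec → from (occurrence-Precedes x (std s) ps-sorted (std-OrderIsoAt s) (toStd ra) (toStd rb))
                         (subst₂ (Precedes x) (sym (lift≡g ra)) (sym (lift≡g rb)) prec))
    (All.tabulate (∈-γ⁻ y)) g-sorted
  γz≡γy : γ (std s) ≡ γ y
  γz≡γy = γ-unique (std s) (γ y) sorted (toStd ∘ ∈-γ⁻ y) (∈-γ⁺ y ∘ subst (λ n → InRange n _) length-std)

avoids-class⇔avoids-γ : ∀ x y → (∀ z → InClass z y → Avoids x z) ⇔ Avoids (γ x) (γ y)
avoids-class⇔avoids-γ x y = mk⇔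
  (λ avoids c → let (z , inClass , x⊇z) = γ-reflects-containment x y c in avoids z inClass x⊇z)
  (λ avoids z (_ , γz≡γy) x⊇z → avoids (subst (Contains (γ x)) γz≡γy (γ-preserves-containment x z x⊇z)))

-- Restricted growth functions

EarlierValues : ℕ → List ℕ → Set
EarlierValues m x = ∀ {c v} → c < length x → m < v → v < at x c → ∃[ w ] (w < c × at x w ≡ v)

rgf-earlier : ∀ m x → rgfFrom m x → EarlierValues m x
rgf-earlier m (a ∷ x) (_ , a≤1+m , _) {zero} _ m<v v<a = ⊥-elim (<⇒≱ m<v (s≤s⁻¹ (≤-trans v<a a≤1+m)))
rgf-earlier m (a ∷ x) (_ , a≤1+m , r) {suc c} {v} (s≤s hc) m<v v<x with <-cmp v a
... | tri≈ _ refl _ = 0 , s≤s z≤n , refl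
... | tri< v<a _ _ = ⊥-elim (<⇒≱ m<v (s≤s⁻¹ (≤-trans v<a a≤1+m)))
... | tri> _ _ a<v with rgf-earlier (m ⊔ a) x r hc (⊔-lub m<v a<v) v<x
...   | w , w<c , e = suc w , s≤s w<c , e

earlier⇒rgf : ∀ m x → (∀ {p} → p < length x → 1 ≤ at x p) → EarlierValues m x → rgfFrom m x
earlier⇒rgf m []      _        _       = _
earlier⇒rgf m (a ∷ x) positive earlier =
  positive (s≤s z≤n) , a≤1+m , earlier⇒rgf (m ⊔ a) x (positive ∘ s≤s) earlier′
  where
  a≤1+m : a ≤ suc m
  a≤1+m with a ≤? suc m
  ... | yes a≤ = a≤
  ... | no a≰ with earlier (s≤s z≤n) ≤-refl (≰⇒> a≰)
  ...   | _ , () , _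
  earlier′ : EarlierValues (m ⊔ a) x
  earlier′ hc m⊔a<v v<x with earlier (s≤s hc) (≤-<-trans (m≤m⊔n m a) m⊔a<v) v<x
  ... | zero  , _         , e = ⊥-elim (<-irrefl e (≤-<-trans (m≤n⊔m m a) m⊔a<v))
  ... | suc w , s≤s w<c , e = w , w<c , e

rgf-positive : ∀ m x → rgfFrom m x → ∀ {a} → a ∈ x → 1 ≤ a
rgf-positive m (b ∷ x) (1≤b , _ , _) (here refl) = 1≤b
rgf-positive m (b ∷ x) (_   , _ , r) (there a∈x) = rgf-positive (m ⊔ b) x r a∈x

rgf-dense : ∀ m x → rgfFrom m x → ∀ {k} → m < k → k ≤ maxL x → k ∈ x
rgf-dense m []      _              m<k k≤0 = ⊥-elim (<⇒≱ (≤-trans m<k k≤0) z≤n)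
rgf-dense m (a ∷ x) (_ , a≤1+m , r) {k} m<k k≤max with <-cmp k a
... | tri≈ _ refl _ = here refl
... | tri< k<a _ _ = ⊥-elim (<⇒≱ m<k (s≤s⁻¹ (≤-trans k<a a≤1+m)))
... | tri> _ _ a<k = there (rgf-dense (m ⊔ a) x r (⊔-lub m<k a<k) k≤maxˣ)
  where
  k≤maxˣ : k ≤ maxL x
  k≤maxˣ with ≤-total a (maxL x)
  ... | inj₁ a≤max = subst (k ≤_) (m≤n⇒m⊔n≡n a≤max) k≤max
  ... | inj₂ max≤a = ⊥-elim (<⇒≱ a<k (subst (k ≤_) (m≥n⇒m⊔n≡m max≤a) k≤max))

rgf⇒IsRGF : ∀ x → rgfFrom 0 x → IsRGF x
rgf⇒IsRGF x r = ((λ _ → rgf-positive 0 x r) , (λ _ 1≤k k≤max → rgf-dense 0 x r 1≤k k≤max)) , r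

γ≡⇒Precedes : ∀ x y → γ x ≡ γ y → ∀ {a b} → InRange (length x) a → InRange (length x) b →
  Precedes x a b → Precedes y a b
γ≡⇒Precedes x y γx≡γy ra rb = sorted-transfer (Precedes-asym x)
  (subst (AllPairs (Precedes x)) γx≡γy (γ-sorted x)) (γ-sorted y) (member ra) (member rb)
  where
  member : ∀ {a} → InRange (length x) a → a ∈ γ y
  member {a} r = subst (a ∈_) γx≡γy (∈-γ⁺ x r)

-- If x(p) < y(p) at the first difference, then x(p) occurs earlier in y, at some w, and so also in x;
-- thus p+1 precedes w+1 for x but not for y.
rgf-first-difference : ∀ x y → rgfFrom 0 y → length x ≡ length y →
  (∀ {a b} → InRange (length x) a → InRange (length x) b → Precedes x a b → Precedes y a b) →
  ∀ {p} → p < length x → (∀ q → q < p → at x q ≡ at y q) → 1 ≤ at x p → ¬ at x p < at y p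
rgf-first-difference x y ry lx≡ly transfer {p} hp prefix 1≤xp xp<yp
  with rgf-earlier 0 y ry (subst (p <_) lx≡ly hp) 1≤xp xp<yp
... | w , w<p , yw≡xp = differs (transfer (s≤s z≤n , hp) (s≤s z≤n , <-trans w<p hp)
                                   (inj₂ (sym (trans (prefix w w<p) yw≡xp) , s≤s w<p)))
  where
  differs : ¬ Precedes y (suc p) (suc w)
  differs (inj₁ yp<yw)       = <-asym xp<yp (subst (at y p <_) yw≡xp yp<yw)
  differs (inj₂ (yp≡yw , _)) = <-irrefl (trans (sym yw≡xp) (sym yp≡yw)) xp<yp

rgf-γ-injective : ∀ x y → rgfFrom 0 x → rgfFrom 0 y → γ x ≡ γ y → x ≡ y
rgf-γ-injective x y rx ry γx≡γy = at-ext-by-prefix x y lx≡ly step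
  where
  lx≡ly : length x ≡ length y
  lx≡ly = trans (sym (length-γ x)) (trans (cong length γx≡γy) (length-γ y))
  step : ∀ p → p < length x → (∀ q → q < p → at x q ≡ at y q) → at x p ≡ at y p
  step p hp prefix with <-cmp (at x p) (at y p)
  ... | tri≈ _ e _ = e
  ... | tri< lt _ _ = ⊥-elim (rgf-first-difference x y ry lx≡ly (γ≡⇒Precedes x y γx≡γy) hp prefix
                                (rgf-positive 0 x rx (at-∈ x hp)) lt)
  ... | tri> _ _ gt = ⊥-elim (rgf-first-difference y x rx (sym lx≡ly) (γ≡⇒Precedes y x (sym γx≡γy)) hp′
                                (λ q q<p → sym (prefix q q<p)) (rgf-positive 0 y ry (at-∈ y hp′)) gt)
    where hp′ = subst (p <_) lx≡ly hp

-- Flat permutations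

Has23-1-at : List ℕ → Set
Has23-1-at π = ∃[ r ] ∃[ k ] (suc r < k × k < length π × at π k < at π r × at π r < at π (suc r))

Has23-1⇔Has23-1-at : ∀ π → Has23-1 π ⇔ Has23-1-at π
Has23-1⇔Has23-1-at π = mk⇔
  (λ (i , j , k , j≡1+i , j<k , πk<πi , πi<πj) →
    toℕ i , toℕ k , subst (_< toℕ k) j≡1+i j<k , toℕ<n k ,
    subst₂ _<_ (lookup≡at π k) (lookup≡at π i) πk<πi ,
    subst₂ _<_ (lookup≡at π i) (trans (lookup≡at π j) (cong (at π) j≡1+i)) πi<πj)
  (λ (r , k , 1+r<k , k<n , πk<πr , πr<π1+r) →
    let 1+r<n = <-trans 1+r<k k<n
        r<n = <-trans ≤-refl 1+r<n
    in fromℕ< r<n , fromℕ< 1+r<n , fromℕ< k<n ,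
       trans (toℕ-fromℕ< 1+r<n) (cong suc (sym (toℕ-fromℕ< r<n))) ,
       subst₂ _<_ (sym (toℕ-fromℕ< 1+r<n)) (sym (toℕ-fromℕ< k<n)) 1+r<k ,
       subst₂ _<_ (sym (lookup-fromℕ< k<n)) (sym (lookup-fromℕ< r<n)) πk<πr ,
       subst₂ _<_ (sym (lookup-fromℕ< r<n)) (sym (lookup-fromℕ< 1+r<n)) πr<π1+r)
  where
  lookup-fromℕ< : ∀ {q} (h : q < length π) → lookup π (fromℕ< h) ≡ at π q
  lookup-fromℕ< h = trans (lookup≡at π _) (cong (at π) (toℕ-fromℕ< h))

∈-idL⁻ : ∀ n {a} → a ∈ idL n → InRange n a
∈-idL⁻ n m with ∈-applyUpTo⁻ suc (subst (_ ∈_) (map-upTo suc n) m)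
... | i , i<n , refl = s≤s z≤n , i<n

∈-idL⁺ : ∀ n {a} → InRange n a → a ∈ idL n
∈-idL⁺ n {suc i} (_ , i<n) = subst (_ ∈_) (sym (map-upTo suc n)) (∈-applyUpTo⁺ suc i<n)

length-idL : ∀ n → length (idL n) ≡ n
length-idL n = trans (length-map suc (upTo n)) (length-applyUpTo (λ i → i) n)

perm-range : ∀ σ → IsPerm σ → ∀ {a} → (a ∈ σ) ⇔ InRange (length σ) a
perm-range σ ((positive , dense) , unique) {a} = mk⇔
  (λ m → positive a m , subst (a ≤_) (sym length≡max) (∈⇒≤maxL σ m))
  (λ (1≤a , a≤n) → dense a 1≤a (subst (a ≤_) length≡max a≤n))
  where
  M = maxL σ
  sameSet : ∀ {b} → (b ∈ σ) ⇔ (b ∈ idL M)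
  sameSet {b} = mk⇔ (λ m → ∈-idL⁺ M (positive b m , ∈⇒≤maxL σ m))
                    (λ m → let (1≤b , b≤M) = ∈-idL⁻ M m in dense b 1≤b b≤M)
  idL-Unique : Unique (idL M)
  idL-Unique = asym-sorted⇒Unique {R = _<_} <-asym (AllPairs.map⁺ {f = suc} (AllPairs.map s≤s (upTo-sorted M)))
  length≡max : length σ ≡ M
  length≡max = trans (↭-length (∼bag⇒↭ (unique∧set⇒bag unique idL-Unique sameSet))) (length-idL M)

range⇒Perm : ∀ π n → Unique π → (∀ {a} → a ∈ π → InRange n a) → (∀ {a} → InRange n a → a ∈ π) → IsPerm π
range⇒Perm π n unique range⁻ range⁺ =
  ((λ _ → proj₁ ∘ range⁻) , λ k 1≤k k≤max → range⁺ (1≤k , ≤-trans k≤max (maxL-≤ π (All.tabulate (proj₂ ∘ range⁻))))) ,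
  unique

-- A 23-1 occurrence a b … c in γ x gives x(a) < x(b) ≤ x(c); the value x(a) then occurs before
-- position c, at some d, and d falls strictly between the adjacent letters a and b of γ x.
rgf-γ-no-23-1 : ∀ x → rgfFrom 0 x → ¬ Has23-1-at (γ x)
rgf-γ-no-23-1 x rx (r , k , 1+r<k , k<n , c<a , a<b) =
  sorted-no-between-adjacent (Precedes-asym x) (γ-sorted x) 1+r<n (∈-γ⁺ x d-range) a≺d d≺b
  where
  π = γ x
  1+r<n = <-trans 1+r<k k<n
  a = at π r
  b = at π (suc r)
  c = at π k
  xa<xb : at x (pred a) < at x (pred b)
  xa<xb = Precedes∧<⇒< x (AllPairs-at (γ-sorted x) ≤-refl 1+r<n) a<b
  xb≤xc : at x (pred b) ≤ at x (pred c)
  xb≤xc = Precedes⇒≤ x (AllPairs-at (γ-sorted x) 1+r<k k<n)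
  a-range = ∈-γ⁻ x (at-∈ π (<-trans ≤-refl 1+r<n))
  c-range = ∈-γ⁻ x (at-∈ π k<n)
  pred< : ∀ {v} → InRange (length x) v → pred v < length x
  pred< {suc v} (_ , h) = h
  earlier = rgf-earlier 0 x rx (pred< c-range) (rgf-positive 0 x rx (at-∈ x (pred< a-range))) (<-≤-trans xa<xb xb≤xc)
  w = proj₁ earlier
  w<c-1 = proj₁ (proj₂ earlier)
  xw≡xa = proj₂ (proj₂ earlier)
  d = suc w
  d-range : InRange (length x) d
  d-range = s≤s z≤n , <-trans w<c-1 (pred< c-range)
  a≺d : Precedes x a d
  a≺d = inj₂ (sym xw≡xa , ≤-<-trans w<c-1 (≤-<-trans pred[n]≤n c<a))
  d≺b : Precedes x d b
  d≺b = inj₁ (subst (_< at x (pred b)) (sym xw≡xa) xa<xb)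

rgf-γ-Flat : ∀ x → rgfFrom 0 x → Flat (γ x)
rgf-γ-Flat x rx =
  range⇒Perm (γ x) (length x) (asym-sorted⇒Unique (Precedes-asym x) (γ-sorted x)) (∈-γ⁻ x) (∈-γ⁺ x) ,
  rgf-γ-no-23-1 x rx ∘ to (Has23-1⇔Has23-1-at (γ x))

at-idL : ∀ n {p} → p < n → at (idL n) p ≡ suc p
at-idL n h = trans (cong (λ L → at L _) (map-upTo suc n)) (at-applyUpTo suc n h)

γ-inv : ∀ σ → IsPerm σ → γ (inv σ) ≡ σ
γ-inv σ pσ = γ-unique (inv σ) σ sorted (toInv ∘ to range) (from range ∘ fromInv)
  where
  n = length σ
  range = perm-range σ pσ
  length-inv : length (inv σ) ≡ n
  length-inv = trans (length-map _ (idL n)) (length-idL n)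
  toInv : ∀ {a} → InRange n a → InRange (length (inv σ)) a
  toInv = subst (λ m → InRange m _) (sym length-inv)
  fromInv : ∀ {a} → InRange (length (inv σ)) a → InRange n a
  fromInv = subst (λ m → InRange m _) length-inv
  inv-at : ∀ {i} → i < n → at (inv σ) (pred (at σ i)) ≡ suc i
  inv-at {i} i<n with to range (at-∈ σ i<n)
  ... | 1≤σi , σi≤n = begin
    at (inv σ) (pred (at σ i))                   ≡⟨ at-map _ (idL n) (subst (pred (at σ i) <_) (sym (length-idL n)) pred<n) ⟩
    suc (indexOf (at (idL n) (pred (at σ i))) σ) ≡⟨ cong (λ v → suc (indexOf v σ)) (at-idL n pred<n) ⟩
    suc (indexOf (suc (pred (at σ i))) σ)        ≡⟨ cong (λ v → suc (indexOf v σ)) (suc-pred _ {{>-nonZero 1≤σi}}) ⟩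
    suc (indexOf (at σ i) σ)                     ≡⟨ cong suc (at-indexOf σ (proj₂ pσ) i<n) ⟩
    suc i                                        ∎
    where
    open ≡-Reasoning
    pred<n : pred (at σ i) < n
    pred<n = pred-mono-< {{>-nonZero 1≤σi}} (s≤s σi≤n)
  sorted : AllPairs (Precedes (inv σ)) σ
  sorted = at⇒AllPairs σ λ i<j j<n → inj₁ (subst₂ _<_ (sym (inv-at (<-trans i<j j<n))) (sym (inv-at j<n)) (s≤s i<j))

ascents : List ℕ → ℕ → ℕ
ascents π zero    = 0
ascents π (suc t) with at π t <? at π (suc t)
... | yes _ = suc (ascents π t)
... | no  _ = ascents π t

ascents-mono : ∀ π {t t′} → t ≤ t′ → ascents π t ≤ ascents π t′
ascents-mono π {t′ = zero}   z≤n  = ≤-refl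
ascents-mono π {t′ = suc t′} t≤1+t′ with m≤n⇒m<n∨m≡n t≤1+t′
... | inj₂ refl       = ≤-refl
... | inj₁ (s≤s t≤t′) = ≤-trans (ascents-mono π t≤t′) step
  where
  step : ascents π t′ ≤ ascents π (suc t′)
  step with at π t′ <? at π (suc t′)
  ... | yes _ = n≤1+n _
  ... | no  _ = ≤-refl

no-ascent⇒descent : ∀ π → Unique π → ∀ {t} → suc t < length π → ¬ at π t < at π (suc t) → at π (suc t) < at π t
no-ascent⇒descent π unique {t} 1+t<n ¬ascent with <-cmp (at π t) (at π (suc t))
... | tri< lt _ _ = ⊥-elim (¬ascent lt)
... | tri≈ _ e _  = ⊥-elim (<-irrefl (at-injective π unique (<-trans ≤-refl 1+t<n) 1+t<n e) ≤-refl)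
... | tri> _ _ gt = gt

ascents-constant⇒descending : ∀ π → Unique π → ∀ {t t′} → t < t′ → t′ < length π →
  ascents π t ≡ ascents π t′ → at π t′ < at π t
ascents-constant⇒descending π unique {t} {suc t′} (s≤s t≤t′) 1+t′<n same with at π t′ <? at π (suc t′)
... | yes _      = ⊥-elim (<-irrefl same (s≤s (ascents-mono π t≤t′)))
... | no ¬ascent with m≤n⇒m<n∨m≡n t≤t′
...   | inj₂ refl = no-ascent⇒descent π unique 1+t′<n ¬ascent
...   | inj₁ t<t′ = <-trans (no-ascent⇒descent π unique 1+t′<n ¬ascent)
                            (ascents-constant⇒descending π unique t<t′ (<-trans ≤-refl 1+t′<n) same)

ascent-at-level : ∀ π {j t} → j < ascents π t → ∃[ r ] (r < t × ascents π r ≡ j × at π r < at π (suc r))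
ascent-at-level π {j} {suc t} j<a with at π t <? at π (suc t)
... | no _ = let (r , r<t , level , ascent) = ascent-at-level π j<a in r , <-trans r<t ≤-refl , level , ascent
... | yes ascent with m≤n⇒m<n∨m≡n (s≤s⁻¹ j<a)
...   | inj₂ refl = t , ≤-refl , refl , ascent
...   | inj₁ j<a′ = let (r , r<t , level , ascent′) = ascent-at-level π j<a′ in r , <-trans r<t ≤-refl , level , ascent′

flat-ascent-below-later : ∀ π → Flat π → ∀ {r t} → suc r ≤ t → t < length π →
  at π r < at π (suc r) → at π r < at π t
flat-ascent-below-later π (perm , no23-1) {r} {t} 1+r≤t t<n ascent with m≤n⇒m<n∨m≡n 1+r≤t
... | inj₂ refl = ascent
... | inj₁ 1+r<t with <-cmp (at π t) (at π r)
...   | tri< πt<πr _ _ = ⊥-elim (no23-1 (from (Has23-1⇔Has23-1-at π) (r , t , 1+r<t , t<n , πt<πr , ascent)))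
...   | tri≈ _ e _     = ⊥-elim (<-irrefl (at-injective π (proj₂ perm) (<-trans 1+r≤t t<n) t<n (sym e)) 1+r≤t)
...   | tri> _ _ πr<πt = πr<πt

rgfOf : List ℕ → List ℕ
rgfOf π = map (λ q → suc (ascents π (indexOf (suc q) π))) (upTo (length π))

module _ (π : List ℕ) (flat : Flat π) where

  private
    n = length π
    perm = proj₁ flat
    unique = proj₂ perm
    range = perm-range π perm

  length-rgfOf : length (rgfOf π) ≡ n
  length-rgfOf = trans (length-map _ (upTo n)) (length-applyUpTo _ n)

  rgfOf-at : ∀ {q} → q < n → at (rgfOf π) q ≡ suc (ascents π (indexOf (suc q) π))
  rgfOf-at {q} q<n = trans (at-map _ (upTo n) (subst (q <_) (sym (length-applyUpTo _ n)) q<n))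
    (cong (λ i → suc (ascents π (indexOf (suc i) π))) (at-applyUpTo (λ i → i) n q<n))

  rgfOf-at-π : ∀ {t} → t < n → at (rgfOf π) (pred (at π t)) ≡ suc (ascents π t)
  rgfOf-at-π {t} t<n with at π t | to range (at-∈ π t<n) | at-indexOf π unique t<n
  ... | suc q | _ , q<n | index = trans (rgfOf-at q<n) (cong (suc ∘ ascents π) index)

  π-sorted : AllPairs (Precedes (rgfOf π)) π
  π-sorted = at⇒AllPairs π λ {i} {j} i<j j<n → let i<n = <-trans i<j j<n in
    case m≤n⇒m<n∨m≡n (ascents-mono π (<⇒≤ i<j)) of λ where
      (inj₁ lt) → inj₁ (subst₂ _<_ (sym (rgfOf-at-π i<n)) (sym (rgfOf-at-π j<n)) (s≤s lt))
      (inj₂ e)  → inj₂ (trans (rgfOf-at-π i<n) (trans (cong suc e) (sym (rgfOf-at-π j<n))) ,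
                        ascents-constant⇒descending π unique i<j j<n e)

  rgfOf-rgf : rgfFrom 0 (rgfOf π)
  rgfOf-rgf = earlier⇒rgf 0 (rgfOf π) positive earlier
    where
    toN : ∀ {q} → q < length (rgfOf π) → q < n
    toN = subst (_ <_) length-rgfOf
    positive : ∀ {q} → q < length (rgfOf π) → 1 ≤ at (rgfOf π) q
    positive h = subst (1 ≤_) (sym (rgfOf-at (toN h))) (s≤s z≤n)
    earlier : EarlierValues 0 (rgfOf π)
    earlier {q} {suc j} h _ v<xq with indexOf-at π (from range (s≤s z≤n , toN h))
    ... | t<n , πt≡1+q with ascent-at-level π (s≤s⁻¹ (subst (suc j <_) (rgfOf-at (toN h)) v<xq))
    ...   | r , r<t , level , ascent =
      pred (at π r) , pred-mono-< {{>-nonZero (proj₁ (to range (at-∈ π r<n)))}} πr<1+q ,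
      trans (rgfOf-at-π r<n) (cong suc level)
      where
      r<n = <-trans r<t t<n
      πr<1+q : at π r < suc q
      πr<1+q = subst (at π r <_) πt≡1+q (flat-ascent-below-later π flat r<t t<n ascent)

  γ-rgfOf : γ (rgfOf π) ≡ π
  γ-rgfOf = γ-unique (rgfOf π) π π-sorted
    (subst (λ m → InRange m _) (sym length-rgfOf) ∘ to range)
    (from range ∘ subst (λ m → InRange m _) length-rgfOf)

γ-image-of-RGF-class : ∀ y π → (∃[ x ] (RGFAv y x × γ x ≡ π)) ⇔ FlatAv (γ y) π
γ-image-of-RGF-class y π = mk⇔
  (λ { (x , ((_ , rx) , avoids) , refl) → rgf-γ-Flat x rx , to (avoids-class⇔avoids-γ x y) avoids })
  (λ (flat , avoids) → rgfOf π ,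
    (rgf⇒IsRGF (rgfOf π) (rgfOf-rgf π flat) ,
     from (avoids-class⇔avoids-γ (rgfOf π) y) (subst (λ ρ → Avoids ρ (γ y)) (sym (γ-rgfOf π flat)) avoids)) ,
    γ-rgfOf π flat)

Flat-avoiders≡γ-image : ∀ σ → IsPerm σ → ∀ π → FlatAv σ π ⇔ (∃[ x ] (RGFAv (inv σ) x × γ x ≡ π))
Flat-avoiders≡γ-image σ pσ π = subst (λ τ → FlatAv τ π ⇔ (∃[ x ] (RGFAv (inv σ) x × γ x ≡ π))) (γ-inv σ pσ)
  (⇔-sym (γ-image-of-RGF-class (inv σ) π))

-- Decidability and counting

_⇔-dec_ : ∀ {A B : Set} → Dec A → Dec B → Dec (A ⇔ B)
A? ⇔-dec B? = map′ (λ (f , g) → mk⇔ f g) (λ e → to e , from e) ((A? →-dec B?) ×-dec (B? →-dec A?))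

OrderIsoAt? : ∀ s y → Dec (OrderIsoAt s y)
OrderIsoAt? s y = (length s ≟ length y) ×-dec
  allUpTo? (λ i → allUpTo? (λ j → ((at s i <? at s j) ⇔-dec (at y i <? at y j)) ×-dec
                                  ((at s i ≟ at s j) ⇔-dec (at y i ≟ at y j))) (length s)) (length s)

sublists : List ℕ → List (List ℕ)
sublists []      = [] ∷ []
sublists (a ∷ x) = map (a ∷_) (sublists x) ++ sublists x

∈-sublists⁺ : ∀ {s} x → s ⊆ x → s ∈ sublists x
∈-sublists⁺ []      []         = here refl
∈-sublists⁺ (a ∷ x) (_ ∷ʳ s⊆x)  = ∈-++⁺ʳ (map (a ∷_) (sublists x)) (∈-sublists⁺ x s⊆x)
∈-sublists⁺ (a ∷ x) (refl ∷ s⊆x) = ∈-++⁺ˡ (∈-map⁺ (a ∷_) (∈-sublists⁺ x s⊆x))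

∈-sublists⁻ : ∀ {s} x → s ∈ sublists x → s ⊆ x
∈-sublists⁻ []      (here refl) = []
∈-sublists⁻ (a ∷ x) m with ∈-++⁻ (map (a ∷_) (sublists x)) m
... | inj₂ m′ = a ∷ʳ ∈-sublists⁻ x m′
... | inj₁ m′ with ∈-map⁻ (a ∷_) m′
...   | _ , m″ , refl = refl ∷ ∈-sublists⁻ x m″

Contains? : ∀ x y → Dec (Contains x y)
Contains? x y = map′
  (λ found → let (s , m , iso) = find found in s , ∈-sublists⁻ x m , from (OrderIso⇔OrderIsoAt s y) iso)
  (λ (s , s⊆x , iso) → lose (∈-sublists⁺ x s⊆x) (to (OrderIso⇔OrderIsoAt s y) iso))
  (any? (λ s → OrderIsoAt? s y) (sublists x))

rgf? : ∀ m x → Dec (rgfFrom m x)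
rgf? m []      = yes _
rgf? m (a ∷ x) = (1 ≤? a) ×-dec (a ≤? suc m) ×-dec rgf? (m ⊔ a) x

RGFAv? : ∀ y x → Dec (RGFAv y x)
RGFAv? y x = map′
  (λ (rx , avoids) → rgf⇒IsRGF x rx , from (avoids-class⇔avoids-γ x y) avoids)
  (λ ((_ , rx) , avoids) → rx , to (avoids-class⇔avoids-γ x y) avoids)
  (rgf? 0 x ×-dec ¬? (Contains? (γ x) (γ y)))

rgfs : ℕ → ℕ → List (List ℕ)
rgfs m zero    = [] ∷ []
rgfs m (suc n) = concatMap (λ a → map (a ∷_) (rgfs (m ⊔ a) n)) (applyUpTo suc (suc m))

rgf-∈-rgfs : ∀ m x → rgfFrom m x → x ∈ rgfs m (length x)
rgf-∈-rgfs m []          _                 = here refl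
rgf-∈-rgfs m (suc a ∷ x) (_ , 1+a≤1+m , r) =
  ∈-concatMap⁺ (λ b → map (b ∷_) (rgfs (m ⊔ b) (length x)))
    (lose (∈-applyUpTo⁺ suc 1+a≤1+m) (∈-map⁺ (suc a ∷_) (rgf-∈-rgfs (m ⊔ suc a) x r)))

enumerate : ∀ (P : List ℕ → Set) → (∀ x → Dec (P x)) → ∀ G → (∀ {x} → P x → x ∈ G) →
  ∃[ L ] (Unique L × (∀ x → (x ∈ L) ⇔ P x))
enumerate P P? G cover = deduplicate (≡-dec _≟_) (filter P? G) , deduplicate-! (filter P? G) , λ x → mk⇔
  (λ m → proj₂ (∈-filter⁻ P? {xs = G} (from (deduplicate-∈⇔ (≡-dec _≟_)) m)))
  (λ p → to (deduplicate-∈⇔ (≡-dec _≟_)) (∈-filter⁺ P? (cover p) p))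

HasCard-image : ∀ {P Q : List ℕ → Set} (f : List ℕ → List ℕ) L → Unique L → (∀ x → (x ∈ L) ⇔ P x) →
  (∀ {a b} → P a → P b → f a ≡ f b → a ≡ b) → (∀ π → Q π ⇔ (∃[ x ] (P x × f x ≡ π))) → HasCard Q (length L)
HasCard-image {P} {Q} f L unique members injective image =
  map f L , AllPairs.map⁺ (AllPairs-map-on (λ pa pb a≢b e → a≢b (injective pa pb e)) inL unique) ,
  (λ π → mk⇔ (mapped π) (hit π)) , length-map f L
  where
  inL : All P L
  inL = All.tabulate (to (members _))
  mapped : ∀ π → π ∈ map f L → Q π
  mapped π m with ∈-map⁻ f m
  ... | x , mx , e = from (image π) (x , to (members x) mx , sym e)
  hit : ∀ π → Q π → π ∈ map f L
  hit π q with to (image π) q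
  ... | x , px , refl = ∈-map⁺ f (from (members x) px)

Flat-RGF-equinumerous : ∀ σ → IsPerm σ → ∀ n → ∃[ k ]
  (HasCard (λ π → length π ≡ n × FlatAv σ π) k × HasCard (λ x → length x ≡ n × RGFAv (inv σ) x) k)
Flat-RGF-equinumerous σ pσ n =
  length L , HasCard-image γ L unique members injective image , L , unique , members , refl
  where
  RGFₙ : List ℕ → Set
  RGFₙ x = length x ≡ n × RGFAv (inv σ) x
  enumeration = enumerate RGFₙ (λ x → (length x ≟ n) ×-dec RGFAv? (inv σ) x) (rgfs 0 n)
    λ (lx , (_ , rx) , _) → subst (λ k → _ ∈ rgfs 0 k) lx (rgf-∈-rgfs 0 _ rx)
  L = proj₁ enumeration
  unique = proj₁ (proj₂ enumeration)
  members = proj₂ (proj₂ enumeration)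
  injective : ∀ {a b} → RGFₙ a → RGFₙ b → γ a ≡ γ b → a ≡ b
  injective (_ , (_ , ra) , _) (_ , (_ , rb) , _) = rgf-γ-injective _ _ ra rb
  image : ∀ π → (length π ≡ n × FlatAv σ π) ⇔ (∃[ x ] (RGFₙ x × γ x ≡ π))
  image π = mk⇔
    (λ (lπ , flatAv) → let (x , rgfAv , γx≡π) = to (Flat-avoiders≡γ-image σ pσ π) flatAv in
      x , (trans (sym (length-γ x)) (trans (cong length γx≡π) lπ) , rgfAv) , γx≡π)
    (λ (x , (lx , rgfAv) , γx≡π) →
      trans (cong length (sym γx≡π)) (trans (length-γ x) lx) , from (Flat-avoiders≡γ-image σ pσ π) (x , rgfAv , γx≡π))

mainTheorem4 :
      ((∀ x → IsRGF x → Flat (γ x))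
        × (∀ x y → IsRGF x → IsRGF y → γ x ≡ γ y → x ≡ y)
        × (∀ π → Flat π → ∃[ x ] (IsRGF x × γ x ≡ π)))
    × (∀ σ → IsPerm σ → ∀ π → FlatAv σ π ⇔ (∃[ x ] (RGFAv (inv σ) x × γ x ≡ π)))
    × (∀ y → IsCayley y → ∀ π → (∃[ x ] (RGFAv y x × γ x ≡ π)) ⇔ FlatAv (γ y) π)
    × (∀ σ → IsPerm σ → ∀ n → ∃[ k ]
        (HasCard (λ π → length π ≡ n × FlatAv σ π) k
          × HasCard (λ x → length x ≡ n × RGFAv (inv σ) x) k))
mainTheorem4 =
  ( (λ x (_ , rx) → rgf-γ-Flat x rx)
  , (λ x y (_ , rx) (_ , ry) → rgf-γ-injective x y rx ry)
  , (λ π flat → rgfOf π , rgf⇒IsRGF (rgfOf π) (rgfOf-rgf π flat) , γ-rgfOf π flat))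
  , Flat-avoiders≡γ-image
  , (λ y _ → γ-image-of-RGF-class y)
  , Flat-RGF-equinumerous
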